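{- Let $m_1,m_2$ be positive integers and let $W=(s_1,\dots,s_{m_1+m_2})$ be a walk from $(0,0)$ to $(m_1,m_2)$ whose steps $s_j$ are each either $h'=(1,0)$ or $v'=(0,1)$. Let $C$ be the set of endpoints of the occurrences of $h'v'$ in $W$, i.e. the points $\sum_{i\le j+1}s_i$ for all $j$ with $s_j=h'$ and $s_{j+1}=v'$. Then $C$ is a strict chain in $[m_1]\times[m_2]$. Moreover, $C$ is a maximal strict chain if and only if $W$ contains no occurrence of $v'h'$ (indices $j$ with $s_j=v'$, $s_{j+1}=h'$) that is disjoint from all occurrences of $h'v'$, i.e. no index $j$ with $s_j=v'$, $s_{j+1}=h'$ such that neither $s_j$ nor $s_{j+1}$ belongs to an occurrence of $h'v'$.
   Context: $[m]=\{1,\dots,m\}$. A strict chain in $[m_1]\times[m_2]$ is a subset any two distinct elements $(a,b),(c,d)$ of which satisfy either $a>c$ and $b>d$, or $a<c$ and $b<d$; it is maximal if it is not properly contained in another strict chain of $[m_1]\times[m_2]$. An occurrence of $h'v'$ consists of two consecutive steps $s_j=h'$, $s_{j+1}=v'$; its endpoint is the point reached after step $s_{j+1}$. -}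

module Defs where

open import Data.Nat using (ℕ; zero; suc; _+_; _≤_; _<_; _>_)
open import Data.Product using (_×_; _,_; Σ; ∃)
open import Data.Sum using (_⊎_)
open import Data.List using (List; []; _∷_; length)
open import Data.Maybe using (Maybe; just; nothing)
open import Relation.Binary.PropositionalEquality using (_≡_; _≢_)
open import Relation.Nullary using (¬_)

data Step : Set where
  h v : Step

Point : Set
Point = ℕ × ℕ

step : Step → Point → Point
step h (a , b) = (suc a , b)
step v (a , b) = (a , suc b)

-- pos W k = s_1 + ... + s_k (the point reached after the first k steps), starting at (0,0)
pos : List Step → ℕ → Point
pos []       k       = (0 , 0)
pos (s ∷ ss) zero    = (0 , 0)
pos (s ∷ ss) (suc k) = step s (pos ss k)

-- W at j = the (j+1)-th step (0-based indexing), if it exists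
_at_ : List Step → ℕ → Maybe Step
[]       at j     = nothing
(s ∷ ss) at zero  = just s
(s ∷ ss) at suc j = ss at j

HV : List Step → ℕ → Set
HV W j = (W at j ≡ just h) × (W at suc j ≡ just v)

VH : List Step → ℕ → Set
VH W j = (W at j ≡ just v) × (W at suc j ≡ just h)

C : List Step → Point → Set
C W p = Σ ℕ λ j → HV W j × (pos W (suc (suc j)) ≡ p)

InHV : List Step → ℕ → Set
InHV W k = Σ ℕ λ i → HV W i × ((i ≡ k) ⊎ (suc i ≡ k))

DisjointVH : List Step → ℕ → Set
DisjointVH W j = VH W j × ¬ InHV W j × ¬ InHV W (suc j)

Subset : Set₁
Subset = Point → Set

InGrid : ℕ → ℕ → Point → Set
InGrid m₁ m₂ (a , b) = (1 ≤ a × a ≤ m₁) × (1 ≤ b × b ≤ m₂)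

StrictlyComparable : Point → Point → Set
StrictlyComparable (a , b) (c , d) = (a > c × b > d) ⊎ (a < c × b < d)

IsStrictChain : ℕ → ℕ → Subset → Set
IsStrictChain m₁ m₂ S =
  (∀ p → S p → InGrid m₁ m₂ p) ×
  (∀ p q → S p → S q → p ≢ q → StrictlyComparable p q)

IsMaximalStrictChain : ℕ → ℕ → Subset → Set₁
IsMaximalStrictChain m₁ m₂ S =
  IsStrictChain m₁ m₂ S ×
  (∀ (T : Subset) → IsStrictChain m₁ m₂ T → (∀ p → S p → T p) → ∀ p → T p → S p)

module Submission where

-- Corners of a monotone lattice path lie strictly above all earlier points of the path, so the
-- endpoints of h'v' corners form a strict chain, and so does the endpoint of a v'h' corner sharing
-- no step with them, together with C; such a corner therefore witnesses that C is not maximal.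
-- Conversely, given a grid point (a , b), let k be the h'-step entering column a and ℓ the
-- v'-step entering row b. If k < ℓ, an h'v' between steps k and ℓ ends weakly south-east of
-- (a , b). If ℓ < k, the path turns from v' to h' somewhere between ℓ and k; that v'h' overlaps
-- an h'v', which ends weakly north-west of (a , b). Either way (a , b) lies in C or is
-- incomparable with a point of C.

open import Defs
open import Data.Nat using (ℕ; zero; suc; _≤_; _<_; _≤′_; ≤′-refl; ≤′-step; z≤n; s≤s; _≤?_)
open import Data.Nat.Properties
  using (_≟_; ≤-refl; ≤-reflexive; ≤-trans; ≤-antisym; <-irrefl; <⇒≤; ≤⇒≯; ≰⇒>; ≤∧≢⇒<; <-cmp;
         n≤1+n; m≤n⇒m≤1+n; ≤⇒≤′; ≤′⇒≤)
open import Data.Product using (_×_; _,_; Σ; proj₁; proj₂; map)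
open import Data.Product.Properties using () renaming (≡-dec to ×-≡-dec)
open import Data.Product.Relation.Binary.Pointwise.NonDependent using (Pointwise)
open import Data.Sum using (_⊎_; inj₁; inj₂)
open import Data.List using (List; []; _∷_; length)
open import Data.Maybe using (Maybe; just; nothing)
open import Data.Maybe.Properties using () renaming (≡-dec to Maybe-≡-dec)
open import Data.Empty using (⊥-elim)
open import Function using (_∘_)
open import Relation.Binary using (DecidableEquality; tri<; tri≈; tri>)
open import Relation.Binary.PropositionalEquality using (_≡_; _≢_; refl; sym; cong; subst)
open import Relation.Nullary using (¬_; Dec; yes; no)

_≟ₛ_ : DecidableEquality Step
h ≟ₛ h = yes refl
h ≟ₛ v = no λ ()
v ≟ₛ h = no λ ()
v ≟ₛ v = yes refl

infix 4 _≟ₘ_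
_≟ₘ_ : DecidableEquality (Maybe Step)
_≟ₘ_ = Maybe-≡-dec _≟ₛ_

_≟ₚ_ : DecidableEquality Point
_≟ₚ_ = ×-≡-dec _≟_ _≟_

h≢v : ∀ {m : Maybe Step} → m ≡ just h → m ≢ just v
h≢v refl ()

coord : Step → Point → ℕ
coord h = proj₁
coord v = proj₂

_≼_ _≺_ : Point → Point → Set
_≼_ = Pointwise _≤_ _≤_
_≺_ = Pointwise _<_ _<_

≼-refl : ∀ {p} → p ≼ p
≼-refl = ≤-refl , ≤-refl

≼-trans : ∀ {p q r} → p ≼ q → q ≼ r → p ≼ r
≼-trans (x≤ , y≤) (x≤′ , y≤′) = ≤-trans x≤ x≤′ , ≤-trans y≤ y≤′

≼-step : ∀ s {p} → p ≼ step s p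
≼-step h = n≤1+n _ , ≤-refl
≼-step v = ≤-refl , n≤1+n _

step-mono : ∀ s {p q} → p ≼ q → step s p ≼ step s q
step-mono h (x≤ , y≤) = s≤s x≤ , y≤
step-mono v (x≤ , y≤) = x≤ , s≤s y≤

step-comm : ∀ s t p → step s (step t p) ≡ step t (step s p)
step-comm h h p = refl
step-comm h v p = refl
step-comm v h p = refl
step-comm v v p = refl

coord-step : ∀ s t p →
  coord s (step t p) ≡ coord s p ⊎ (t ≡ s × coord s (step t p) ≡ suc (coord s p))
coord-step h h p = inj₂ (refl , refl)
coord-step h v p = inj₁ refl
coord-step v h p = inj₁ refl
coord-step v v p = inj₂ (refl , refl)

StrictlyComparable-sym : ∀ {p q} → StrictlyComparable p q → StrictlyComparable q p
StrictlyComparable-sym (inj₁ q≺p) = inj₂ q≺p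
StrictlyComparable-sym (inj₂ p≺q) = inj₁ p≺q

StrictlyComparable-irrefl : ∀ {p} → ¬ StrictlyComparable p p
StrictlyComparable-irrefl (inj₁ (x<x , _)) = <-irrefl refl x<x
StrictlyComparable-irrefl (inj₂ (x<x , _)) = <-irrefl refl x<x

southeast⇒incomparable : ∀ {p q} → proj₁ p ≤ proj₁ q → proj₂ q ≤ proj₂ p → ¬ StrictlyComparable p q
southeast⇒incomparable x≤ y≤ (inj₁ (x> , _)) = ≤⇒≯ x≤ x>
southeast⇒incomparable x≤ y≤ (inj₂ (_ , y<)) = ≤⇒≯ y≤ y<

northwest⇒incomparable : ∀ {p q} → proj₁ q ≤ proj₁ p → proj₂ p ≤ proj₂ q → ¬ StrictlyComparable p q
northwest⇒incomparable x≤ y≤ = southeast⇒incomparable x≤ y≤ ∘ StrictlyComparable-sym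

maximal⇒¬comparable-to-all : ∀ {m₁ m₂ S p} → IsMaximalStrictChain m₁ m₂ S → InGrid m₁ m₂ p →
  ¬ (∀ q → S q → StrictlyComparable p q)
maximal⇒¬comparable-to-all {m₁} {m₂} {S} {p} ((S-grid , S-comparable) , S-maximal) p-grid p~S =
  StrictlyComparable-irrefl (p~S p (S-maximal T (T-grid , T-comparable) (λ _ → inj₁) p (inj₂ refl)))
  where
  T : Subset
  T q = S q ⊎ q ≡ p

  T-grid : ∀ q → T q → InGrid m₁ m₂ q
  T-grid q (inj₁ Sq) = S-grid q Sq
  T-grid q (inj₂ refl) = p-grid

  T-comparable : ∀ q r → T q → T r → q ≢ r → StrictlyComparable q r
  T-comparable q r (inj₁ Sq) (inj₁ Sr) q≢r = S-comparable q r Sq Sr q≢r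
  T-comparable q r (inj₁ Sq) (inj₂ refl) _ = StrictlyComparable-sym (p~S q Sq)
  T-comparable q r (inj₂ refl) (inj₁ Sr) _ = p~S r Sr
  T-comparable q r (inj₂ refl) (inj₂ refl) q≢r = ⊥-elim (q≢r refl)

incomparable-member⇒maximal : ∀ {m₁ m₂ S} → IsStrictChain m₁ m₂ S →
  (∀ p → InGrid m₁ m₂ p → Σ Point λ q → S q × ¬ StrictlyComparable p q) →
  IsMaximalStrictChain m₁ m₂ S
incomparable-member⇒maximal {m₁} {m₂} {S} S-chain witness = S-chain , maximal
  where
  maximal : ∀ T → IsStrictChain m₁ m₂ T → (∀ p → S p → T p) → ∀ p → T p → S p
  maximal T (T-grid , T-comparable) S⊆T p Tp with witness p (T-grid p Tp)
  ... | q , Sq , p≁q with p ≟ₚ q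
  ...   | yes refl = Sq
  ...   | no p≢q = ⊥-elim (p≁q (T-comparable p q Tp (S⊆T q Sq) p≢q))

no-step-after-end : ∀ W {k s} → W at k ≡ nothing → W at suc k ≢ just s
no-step-after-end [] _ ()
no-step-after-end (_ ∷ W) {zero} ()
no-step-after-end (_ ∷ W) {suc k} end = no-step-after-end W end

pos-zero : ∀ W → pos W 0 ≡ (0 , 0)
pos-zero [] = refl
pos-zero (_ ∷ _) = refl

pos-suc : ∀ W {k s} → W at k ≡ just s → pos W (suc k) ≡ step s (pos W k)
pos-suc (t ∷ W) {zero} refl rewrite pos-zero W = refl
pos-suc (t ∷ W) {suc k} {s} sₖ rewrite pos-suc W sₖ = step-comm t s (pos W k)

pos-nothing : ∀ W {k} → W at k ≡ nothing → pos W (suc k) ≡ pos W k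
pos-nothing [] _ = refl
pos-nothing (t ∷ W) {suc k} end = cong (step t) (pos-nothing W end)

pos-mono : ∀ W {i k} → i ≤ k → pos W i ≼ pos W k
pos-mono W = go ∘ ≤⇒≤′
  where
  go : ∀ {i k} → i ≤′ k → pos W i ≼ pos W k
  go ≤′-refl = ≼-refl
  go {k = suc k} (≤′-step i≤′k) with W at k in e
  ... | nothing rewrite pos-nothing W e = go i≤′k
  ... | just s rewrite pos-suc W e = ≼-trans (go i≤′k) (≼-step s)

pos-≼-end : ∀ W k → pos W k ≼ pos W (length W)
pos-≼-end [] _ = ≼-refl
pos-≼-end (_ ∷ _) zero = z≤n , z≤n
pos-≼-end (s ∷ W) (suc k) = step-mono s (pos-≼-end W k)

coord-pos-zero : ∀ W s → coord s (pos W 0) ≡ 0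
coord-pos-zero W h = cong proj₁ (pos-zero W)
coord-pos-zero W v = cong proj₂ (pos-zero W)

coord-pos-suc : ∀ W s k →
  coord s (pos W (suc k)) ≡ coord s (pos W k) ⊎
  (W at k ≡ just s × coord s (pos W (suc k)) ≡ suc (coord s (pos W k)))
coord-pos-suc W s k with W at k in e
... | nothing rewrite pos-nothing W e = inj₁ refl
... | just t rewrite pos-suc W e with coord-step s t (pos W k)
...   | inj₁ same = inj₁ same
...   | inj₂ (refl , up) = inj₂ (refl , up)

entering-step : ∀ W s n {a} → 1 ≤ a → a ≤ coord s (pos W n) →
  Σ ℕ λ k → W at k ≡ just s × coord s (pos W (suc k)) ≡ a
entering-step W s zero 1≤a a≤ = ⊥-elim (≤⇒≯ (subst (_ ≤_) (coord-pos-zero W s) a≤) 1≤a)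
entering-step W s (suc n) 1≤a a≤ with _ ≤? coord s (pos W n)
... | yes a≤′ = entering-step W s n 1≤a a≤′
... | no a≰ with coord-pos-suc W s n
...   | inj₁ same = ⊥-elim (a≰ (subst (_ ≤_) same a≤))
...   | inj₂ (sₙ , up) = n , sₙ , ≤-antisym (subst (_≤ _) (sym up) (≰⇒> a≰)) a≤

Turn : List Step → ℕ → Set
Turn W j = HV W j ⊎ VH W j

turn-endpoint : ∀ W {j} → Turn W j → pos W (suc (suc j)) ≡ step h (step v (pos W j))
turn-endpoint W (inj₁ (hⱼ , vⱼ₊₁)) rewrite pos-suc W vⱼ₊₁ | pos-suc W hⱼ = refl
turn-endpoint W (inj₂ (vⱼ , hⱼ₊₁)) rewrite pos-suc W hⱼ₊₁ | pos-suc W vⱼ = refl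

turn-above : ∀ W {k j} → k ≤ j → Turn W j → pos W k ≺ pos W (suc (suc j))
turn-above W k≤j t rewrite turn-endpoint W t = map s≤s s≤s (pos-mono W k≤j)

turn-endpoint-inGrid : ∀ W {m₁ m₂ j} → pos W (length W) ≡ (m₁ , m₂) → Turn W j →
  InGrid m₁ m₂ (pos W (suc (suc j)))
turn-endpoint-inGrid W {j = j} refl t
  with subst (_≺ pos W (suc (suc j))) (pos-zero W) (turn-above W z≤n t) | pos-≼-end W (suc (suc j))
... | 0<x , 0<y | x≤ , y≤ = (0<x , x≤) , (0<y , y≤)

separated : ∀ {i j} → i ≢ j → suc i ≢ j → suc j ≢ i → suc i < j ⊎ suc j < i
separated {i} {j} i≢j i+1≢j j+1≢i with <-cmp i j
... | tri< i<j _ _ = inj₁ (≤∧≢⇒< i<j i+1≢j)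
... | tri≈ _ i≡j _ = ⊥-elim (i≢j i≡j)
... | tri> _ _ j<i = inj₂ (≤∧≢⇒< j<i j+1≢i)

separated-turns-comparable : ∀ W {i j} → Turn W i → Turn W j → suc i < j ⊎ suc j < i →
  StrictlyComparable (pos W (suc (suc i))) (pos W (suc (suc j)))
separated-turns-comparable W tᵢ tⱼ (inj₁ i+1<j) = inj₂ (turn-above W i+1<j tⱼ)
separated-turns-comparable W tᵢ tⱼ (inj₂ j+1<i) = inj₁ (turn-above W j+1<i tᵢ)

C-isStrictChain : ∀ W {m₁ m₂} → pos W (length W) ≡ (m₁ , m₂) → IsStrictChain m₁ m₂ (C W)
C-isStrictChain W end = (λ { _ (i , hv , refl) → turn-endpoint-inGrid W end (inj₁ hv) }) , comparable
  where
  comparable : ∀ p q → C W p → C W q → p ≢ q → StrictlyComparable p q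
  comparable _ _ (i , (hᵢ , vᵢ₊₁) , refl) (j , (hⱼ , vⱼ₊₁) , refl) p≢q =
    separated-turns-comparable W (inj₁ (hᵢ , vᵢ₊₁)) (inj₁ (hⱼ , vⱼ₊₁))
      (separated (λ { refl → p≢q refl }) (λ { refl → h≢v hⱼ vᵢ₊₁ }) (λ { refl → h≢v hᵢ vⱼ₊₁ }))

disjointVH-comparable-to-C : ∀ W {j} → DisjointVH W j →
  ∀ q → C W q → StrictlyComparable (pos W (suc (suc j))) q
disjointVH-comparable-to-C W (vh , ∉HVⱼ , ∉HVⱼ₊₁) _ (i , hv , refl) =
  separated-turns-comparable W (inj₂ vh) (inj₁ hv)
    (separated (λ { refl → h≢v (proj₁ hv) (proj₁ vh) })
               (λ j+1≡i → ∉HVⱼ₊₁ (i , hv , inj₁ (sym j+1≡i)))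
               (λ i+1≡j → ∉HVⱼ (i , hv , inj₂ i+1≡j)))

h-precedes? : ∀ W j → Dec (Σ ℕ λ i → suc i ≡ j × W at i ≡ just h)
h-precedes? W zero = no λ { (_ , () , _) }
h-precedes? W (suc i) with W at i ≟ₘ just h
... | yes hᵢ = yes (i , refl , hᵢ)
... | no ¬hᵢ = no λ { (_ , refl , hᵢ) → ¬hᵢ hᵢ }

VH-meets-HV : ∀ W → ¬ Σ ℕ (DisjointVH W) → ∀ {j} → VH W j →
  Σ ℕ λ i → HV W i × j ≤ suc i × i ≤ suc j
VH-meets-HV W nd {j} (vⱼ , hⱼ₊₁) with W at suc (suc j) ≟ₘ just v | h-precedes? W j
... | yes vⱼ₊₂ | _ = suc j , (hⱼ₊₁ , vⱼ₊₂) , m≤n⇒m≤1+n (n≤1+n j) , ≤-refl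
... | no _ | yes (i , refl , hᵢ) = i , (hᵢ , vⱼ) , ≤-refl , m≤n⇒m≤1+n (n≤1+n i)
... | no ¬vⱼ₊₂ | no ¬hⱼ₋₁ = ⊥-elim (nd (j , (vⱼ , hⱼ₊₁) , ∉HVⱼ , ∉HVⱼ₊₁))
  where
  ∉HVⱼ : ¬ InHV W j
  ∉HVⱼ (i , (hᵢ , _) , inj₁ refl) = h≢v hᵢ vⱼ
  ∉HVⱼ (i , (hᵢ , _) , inj₂ i+1≡j) = ¬hⱼ₋₁ (i , i+1≡j , hᵢ)
  ∉HVⱼ₊₁ : ¬ InHV W (suc j)
  ∉HVⱼ₊₁ (i , (_ , vᵢ₊₁) , inj₁ refl) = ¬vⱼ₊₂ vᵢ₊₁
  ∉HVⱼ₊₁ (i , (hᵢ , _) , inj₂ refl) = h≢v hᵢ vⱼ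

HV-between : ∀ W {k ℓ} → k ≤′ ℓ → W at k ≡ just h → W at ℓ ≡ just v →
  Σ ℕ λ i → HV W i × k ≤ i × i < ℓ
HV-between W ≤′-refl hₖ vℓ = ⊥-elim (h≢v hₖ vℓ)
HV-between W {ℓ = suc ℓ} (≤′-step k≤′ℓ) hₖ vℓ₊₁ with W at ℓ in e
... | just h = ℓ , (e , vℓ₊₁) , ≤′⇒≤ k≤′ℓ , ≤-refl
... | just v with HV-between W k≤′ℓ hₖ e
...   | i , hv , k≤i , i<ℓ = i , hv , k≤i , m≤n⇒m≤1+n i<ℓ
HV-between W {ℓ = suc ℓ} (≤′-step k≤′ℓ) hₖ vℓ₊₁ | nothing = ⊥-elim (no-step-after-end W e vℓ₊₁)

HV-straddling : ∀ W → ¬ Σ ℕ (DisjointVH W) → ∀ {ℓ k} → ℓ ≤′ k → W at ℓ ≡ just v → W at k ≡ just h →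
  Σ ℕ λ i → HV W i × ℓ ≤ suc i × i ≤ k
HV-straddling W _ ≤′-refl vℓ hₖ = ⊥-elim (h≢v hₖ vℓ)
HV-straddling W nd {k = suc k} (≤′-step ℓ≤′k) vℓ hₖ₊₁ with W at k in e
... | just h with HV-straddling W nd ℓ≤′k vℓ e
...   | i , hv , ℓ≤i+1 , i≤k = i , hv , ℓ≤i+1 , m≤n⇒m≤1+n i≤k
HV-straddling W nd {k = suc k} (≤′-step ℓ≤′k) vℓ hₖ₊₁ | just v with VH-meets-HV W nd (e , hₖ₊₁)
...   | i , hv , k≤i+1 , i≤k+1 = i , hv , ≤-trans (≤′⇒≤ ℓ≤′k) k≤i+1 , i≤k+1
HV-straddling W nd {k = suc k} (≤′-step ℓ≤′k) vℓ hₖ₊₁ | nothing =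
  ⊥-elim (no-step-after-end W e hₖ₊₁)

incomparable-corner : ∀ W {m₁ m₂} → pos W (length W) ≡ (m₁ , m₂) → ¬ Σ ℕ (DisjointVH W) →
  ∀ p → InGrid m₁ m₂ p → Σ Point λ q → C W q × ¬ StrictlyComparable p q
incomparable-corner W refl nd (a , b) ((1≤a , a≤m₁) , (1≤b , b≤m₂))
  with entering-step W h (length W) 1≤a a≤m₁ | entering-step W v (length W) 1≤b b≤m₂
... | k , hₖ , refl | ℓ , vℓ , refl with <-cmp k ℓ
... | tri≈ _ refl _ = ⊥-elim (h≢v hₖ vℓ)
... | tri< k<ℓ _ _ with HV-between W (≤⇒≤′ (<⇒≤ k<ℓ)) hₖ vℓ
...   | i , hv , k≤i , i<ℓ =
  pos W (suc (suc i)) , (i , hv , refl) ,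
  southeast⇒incomparable (proj₁ (pos-mono W (s≤s (m≤n⇒m≤1+n k≤i)))) (proj₂ (pos-mono W (s≤s i<ℓ)))
incomparable-corner W refl nd _ _ | k , hₖ , refl | ℓ , vℓ , refl | tri> _ _ ℓ<k
  with HV-straddling W nd (≤⇒≤′ (<⇒≤ ℓ<k)) vℓ hₖ
...   | i , hv , ℓ≤i+1 , i≤k =
  pos W (suc (suc i)) , (i , hv , refl) ,
  northwest⇒incomparable
    (≤-trans (≤-reflexive (cong proj₁ (pos-suc W (proj₂ hv)))) (proj₁ (pos-mono W (s≤s i≤k))))
    (proj₂ (pos-mono W (s≤s ℓ≤i+1)))

proposition10 : (m₁ m₂ : ℕ) → 1 ≤ m₁ → 1 ≤ m₂ → (W : List Step) →
    pos W (length W) ≡ (m₁ , m₂) →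
    IsStrictChain m₁ m₂ (C W) ×
    ((IsMaximalStrictChain m₁ m₂ (C W) → ¬ (Σ ℕ λ j → DisjointVH W j)) ×
     (¬ (Σ ℕ λ j → DisjointVH W j) → IsMaximalStrictChain m₁ m₂ (C W)))
proposition10 m₁ m₂ _ _ W end = C-chain , maximal⇒no-disjointVH , no-disjointVH⇒maximal
  where
  C-chain : IsStrictChain m₁ m₂ (C W)
  C-chain = C-isStrictChain W end

  maximal⇒no-disjointVH : IsMaximalStrictChain m₁ m₂ (C W) → ¬ Σ ℕ (DisjointVH W)
  maximal⇒no-disjointVH maximal (j , disjoint) =
    maximal⇒¬comparable-to-all maximal (turn-endpoint-inGrid W end (inj₂ (proj₁ disjoint)))
      (disjointVH-comparable-to-C W disjoint)

  no-disjointVH⇒maximal : ¬ Σ ℕ (DisjointVH W) → IsMaximalStrictChain m₁ m₂ (C W)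
  no-disjointVH⇒maximal nd = incomparable-member⇒maximal C-chain (incomparable-corner W end nd)
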